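{- Let $p$ be a prime, let $l,n\in\mathbb{N}$ with $n>p$, and let $r\in\mathbb{Z}$. Then $$F^{(l)}_p(n,r)+[\![l>0]\!]F^{(l-1)}_p(n-p,r)\equiv-\sum_{k=1}^{p-1}\frac1k\sum_{j=0}^{k-1}F^{(l)}_p(n-p+1,r-j)\pmod p.$$
   Context: For a prime $p$, $l,n\in\mathbb{N}$ and $r\in\mathbb{Z}$, $$F^{(l)}_p(n,r)=(-p)^{ -\lfloor (n-lp-1)/(p-1)\rfloor}\sum_{k\equiv r\,(\mathrm{mod}\ p)}\binom nk(-1)^k\binom{(k-r)/p}{l},$$ which is an integer. $[\![A]\!]$ is $1$ if $A$ holds and $0$ otherwise (so the term $F^{(l-1)}_p$ is absent when $l=0$). Congruences of rationals modulo $p$ mean the difference divided by $p$ is a $p$-adic integer. -}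

module Defs where

open import Data.Nat as ℕ using (ℕ; zero; suc; _∸_)
open import Data.Nat.Properties using (m^n≢0)
open import Data.Nat.Divisibility using (_∣_)
open import Data.Nat.Combinatorics using (_C_)
open import Data.Integer as ℤ using (ℤ; +_; -[1+_]; -1ℤ)
open import Data.Rational as ℚ using (ℚ; 0ℚ; 1ℚ; ↧ₙ_)
open import Data.Product using (Σ; _×_)
open import Relation.Nullary using (¬_)
open import Relation.Binary.PropositionalEquality using (_≡_)

sumℤ : ℕ → (ℕ → ℤ) → ℤ
sumℤ zero    f = + 0
sumℤ (suc m) f = sumℤ m f ℤ.+ f m

sumℚ : ℕ → (ℕ → ℚ) → ℚ
sumℚ zero    f = 0ℚ
sumℚ (suc m) f = sumℚ m f ℚ.+ f m

toℚ : ℤ → ℚ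
toℚ z = z ℚ./ 1

-- generalized binomial coefficient  binom(x, l) = x(x-1)...(x-l+1)/l!  for x ∈ ℤ
gbinom : ℤ → ℕ → ℚ
gbinom x zero    = 1ℚ
gbinom x (suc l) = gbinom x l ℚ.* ((x ℤ.- + l) ℚ./ suc l)

-- The defining sum  Σ_{k ≡ r (mod p)} binom(n,k) (-1)^k binom((k-r)/p, l)
-- for p = suc (suc q) (i.e. p ≥ 2); only 0 ≤ k ≤ n contribute since binom(n,k)=0 otherwise.
FSum : (q : ℕ) → ℕ → ℕ → ℤ → ℚ
FSum q l n r = sumℚ (suc n) term
  where
  p = suc (suc q)
  term : ℕ → ℚ
  term k with (+ k ℤ.- r) ℤ.%ℕ p
  ... | zero  = toℚ ((+ (n C k)) ℤ.* (-1ℤ ℤ.^ k)) ℚ.* gbinom ((+ k ℤ.- r) ℤ./ℕ p) l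
  ... | suc _ = 0ℚ

-- (-p)^(-e) for p = suc (suc q), e ∈ ℤ
negPowNeg : (q : ℕ) → ℤ → ℚ
negPowNeg q (+ m)    = (-1ℤ ℤ.^ m) ℚ./ (p ℕ.^ m)
  where p = suc (suc q)
        instance _ = m^n≢0 p m
negPowNeg q -[1+ m ] = toℚ ((ℤ.- (+ suc (suc q))) ℤ.^ suc m)

-- F^{(l)}_p(n,r) = (-p)^{-⌊(n - l p - 1)/(p-1)⌋} Σ_{k ≡ r (p)} binom(n,k) (-1)^k binom((k-r)/p, l)
-- (floor division: ℤ._/ℕ_ rounds toward -∞, remainder in [0, p-1)).
-- Defined for p ≥ 2; for p ∈ {0,1} (never prime) a junk value 0 is returned.
F : (p l n : ℕ) → ℤ → ℚ
F zero          l n r = 0ℚ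
F (suc zero)    l n r = 0ℚ
F (suc (suc q)) l n r =
  negPowNeg q ((+ n ℤ.- + (l ℕ.* p) ℤ.- + 1) ℤ./ℕ suc q) ℚ.* FSum q l n r
  where p = suc (suc q)

lowerTerm : (p l m : ℕ) → ℤ → ℚ
lowerTerm p zero    m r = 0ℚ
lowerTerm p (suc l) m r = F p l m r

IsPAdicInt : ℕ → ℚ → Set
IsPAdicInt p x = ¬ (p ∣ ↧ₙ x)

_≡_[modℚ_] : ℚ → ℚ → ℕ → Set
a ≡ b [modℚ p ] = Σ ℚ (λ y → IsPAdicInt p y × (a ℚ.- b ≡ toℚ (+ p) ℚ.* y))

{-# OPTIONS --safe #-}

-- Write F^{(l)}(n,r) = (-p)^{-e(n,l)} S_l(n,r), where S_l is the defining sum and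
-- e(n,l) = ⌊(n-lp-1)/(p-1)⌋, and let m = n - p. Iterating Pascal's rule in n gives
-- S_l(m+p,r) = Σ_{i<p} (-1)^i C(p-1,i) S_l(m+1,r-i), and (-1)^i C(p-1,i) = 1 - p c_i with
-- c_i = Σ_{k<i} (-1)^k C(p-1,k)/(k+1), so that c_i ≡ H_i (mod p). Pascal's rule for
-- binom((k-r)/p, l) makes the window Σ_{i<p} S_l(m+1,r-i) telescope to -[l>0] S_{l-1}(m,r).
-- Because e drops by one from m+p to m+1 and e(m+p,l+1) = e(m,l), the powers of -p match up to
--   F^{(l)}(m+p,r) + [l>0] F^{(l-1)}(m,r) = Σ_{i<p} c_i F^{(l)}(m+1,r-i)   and
--   Σ_{i<p} F^{(l)}(m+1,r-i) = p [l>0] F^{(l-1)}(m,r).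
-- For n < p the exponent e is ≤ 0, so the recurrence shows by strong induction that every F is
-- p-integral. Exchanging summations, the right-hand side of the congruence is
-- -Σ_{i<p} (H_{p-1} - H_i) F^{(l)}(m+1,r-i), so by the recurrence the difference of the two sides
-- is Σ_i (c_i - H_i) F^{(l)}(m+1,r-i) + p H_{p-1} [l>0] F^{(l-1)}(m,r): p times a p-integral number.

module Submission where

open import Defs
open import Data.Nat using (ℕ; suc; _<_; _∸_; _+_)
open import Data.Nat.Primality using (Prime)
open import Data.Integer using (ℤ; +_; _-_)
open import Data.Rational using (ℚ; _/_; _*_; -_) renaming (_+_ to _+ℚ_)

open import Data.Empty using (⊥-elim)
open import Data.Nat using (zero; NonZero; z≤n; s≤s)
open import Data.Nat.Combinatorics using (_C_; k>n⇒nCk≡0; nCk+nC[k+1]≡[n+1]C[k+1]; nC1≡n)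
open import Data.Nat.Divisibility using (_∣_; ∣1⇒≡1; ∣n⇒∣m*n; ∣⇒≤)
open import Data.Nat.Induction using (<-rec)
open import Data.Nat.Primality using (euclidsLemma; ¬prime[0]; ¬prime[1])
open import Data.Integer using (-[1+_]; -1ℤ)
open import Data.Integer.DivMod using (a≡a%ℕn+[a/ℕn]*n; [n/ℕd]*d≤n; n<s[n/ℕd]*d)
open import Data.Integer.Tactic.RingSolver using (solve-∀)
open import Data.Product using (_,_)
open import Data.Sum using ([_,_]′)
open import Function using (_∘_)
open import Data.Rational.Solver using (module +-*-Solver)
open import Relation.Binary.PropositionalEquality
open import Relation.Nullary using (¬_; yes; no)
import Data.Nat as ℕ
import Data.Nat.Coprimality as Coprimality
import Data.Nat.Properties as ℕP
import Data.Integer as ℤ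
import Data.Integer.Properties as ℤP
import Data.Rational as ℚ
import Data.Rational.Properties as ℚP
import Data.Rational.Unnormalised as ℚᵘ
import Data.Rational.Unnormalised.Properties as ℚᵘP

open ≡-Reasoning
open +-*-Solver using (solve; _:=_; con; _:+_; _:-_; :-_; _:*_)

toℚ-via-ℚᵘ : ∀ z {x} → ℚᵘ.mkℚᵘ z 0 ℚᵘ.≃ ℚ.toℚᵘ x → toℚ z ≡ x
toℚ-via-ℚᵘ z e = ℚP.toℚᵘ-injective (ℚᵘP.≃-trans (ℚP.toℚᵘ-fromℚᵘ (ℚᵘ.mkℚᵘ z 0)) e)

toℚᵘ-toℚ : ∀ z → ℚ.toℚᵘ (toℚ z) ℚᵘ.≃ ℚᵘ.mkℚᵘ z 0
toℚᵘ-toℚ z = ℚP.toℚᵘ-fromℚᵘ (ℚᵘ.mkℚᵘ z 0)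

toℚ-homo-+ : ∀ a b → toℚ (a ℤ.+ b) ≡ toℚ a +ℚ toℚ b
toℚ-homo-+ a b = toℚ-via-ℚᵘ (a ℤ.+ b) (ℚᵘP.≃-trans (ℚᵘ.*≡* (eq a b)) (ℚᵘP.≃-sym
  (ℚᵘP.≃-trans (ℚP.toℚᵘ-homo-+ (toℚ a) (toℚ b)) (ℚᵘP.+-cong (toℚᵘ-toℚ a) (toℚᵘ-toℚ b)))))
  where
  eq : ∀ a b → (a ℤ.+ b) ℤ.* (+ 1 ℤ.* + 1) ≡ (a ℤ.* + 1 ℤ.+ b ℤ.* + 1) ℤ.* + 1
  eq = solve-∀

toℚ-homo-* : ∀ a b → toℚ (a ℤ.* b) ≡ toℚ a * toℚ b
toℚ-homo-* a b = toℚ-via-ℚᵘ (a ℤ.* b) (ℚᵘP.≃-trans (ℚᵘ.*≡* (eq a b)) (ℚᵘP.≃-sym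
  (ℚᵘP.≃-trans (ℚP.toℚᵘ-homo-* (toℚ a) (toℚ b)) (ℚᵘP.*-cong (toℚᵘ-toℚ a) (toℚᵘ-toℚ b)))))
  where
  eq : ∀ a b → (a ℤ.* b) ℤ.* (+ 1 ℤ.* + 1) ≡ (a ℤ.* b) ℤ.* + 1
  eq = solve-∀

toℚ-homo‿- : ∀ a → toℚ (ℤ.- a) ≡ - toℚ a
toℚ-homo‿- a = toℚ-via-ℚᵘ (ℤ.- a) (ℚᵘP.≃-sym
  (ℚᵘP.≃-trans (ℚP.toℚᵘ-homo‿- (toℚ a)) (ℚᵘP.-‿cong (toℚᵘ-toℚ a))))

toℚ-homo-minus : ∀ a b → toℚ (a - b) ≡ toℚ a ℚ.- toℚ b
toℚ-homo-minus a b = trans (toℚ-homo-+ a (ℤ.- b)) (cong (toℚ a +ℚ_) (toℚ-homo‿- b))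

toℚ-pos-* : ∀ m n → toℚ (+ (m ℕ.* n)) ≡ toℚ (+ m) * toℚ (+ n)
toℚ-pos-* m n = trans (cong toℚ (ℤP.pos-* m n)) (toℚ-homo-* (+ m) (+ n))

toℚ-injective : ∀ {a b} → toℚ a ≡ toℚ b → a ≡ b
toℚ-injective {a} {b} e = begin
  a         ≡⟨ ℤP.*-identityʳ a ⟨
  a ℤ.* + 1 ≡⟨ ℚᵘP.drop-*≡* (ℚᵘP.≃-trans (ℚᵘP.≃-sym (toℚᵘ-toℚ a))
                 (ℚᵘP.≃-trans (ℚP.toℚᵘ-cong e) (toℚᵘ-toℚ b))) ⟩
  b ℤ.* + 1 ≡⟨ ℤP.*-identityʳ b ⟩
  b         ∎

i/n*n≡i : ∀ i n .{{_ : NonZero n}} → (i / n) * toℚ (+ n) ≡ toℚ i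
i/n*n≡i i n@(suc d) = sym (toℚ-via-ℚᵘ i (ℚᵘP.≃-sym
  (ℚᵘP.≃-trans (ℚP.toℚᵘ-homo-* (i / n) (toℚ (+ n)))
  (ℚᵘP.≃-trans (ℚᵘP.*-cong (ℚP.toℚᵘ-fromℚᵘ (ℚᵘ.mkℚᵘ i d)) (toℚᵘ-toℚ (+ n)))
  (ℚᵘ.*≡* (eq i (+ n)))))))
  where
  eq : ∀ i n → (i ℤ.* n) ℤ.* + 1 ≡ i ℤ.* (n ℤ.* + 1)
  eq = solve-∀

*-cancelʳ-toℚ : ∀ n .{{_ : NonZero n}} {x y} → x * toℚ (+ n) ≡ y * toℚ (+ n) → x ≡ y
*-cancelʳ-toℚ n {x} {y} e = begin
  x                         ≡⟨ scale x ⟨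
  x * toℚ (+ n) * (+ 1 / n) ≡⟨ cong (_* (+ 1 / n)) e ⟩
  y * toℚ (+ n) * (+ 1 / n) ≡⟨ scale y ⟩
  y                         ∎
  where
  scale : ∀ x → x * toℚ (+ n) * (+ 1 / n) ≡ x
  scale x = begin
    x * toℚ (+ n) * (+ 1 / n)   ≡⟨ ℚP.*-assoc x _ _ ⟩
    x * (toℚ (+ n) * (+ 1 / n)) ≡⟨ cong (x *_) (trans (ℚP.*-comm _ (+ 1 / n)) (i/n*n≡i (+ 1) n)) ⟩
    x * ℚ.1ℚ                    ≡⟨ ℚP.*-identityʳ x ⟩
    x                           ∎

1/[1+_] : ℕ → ℚ
1/[1+ k ] = + 1 / suc k

1/[1+k]*[1+k]≡1 : ∀ k → 1/[1+ k ] * toℚ (+ suc k) ≡ ℚ.1ℚ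
1/[1+k]*[1+k]≡1 k = i/n*n≡i (+ 1) (suc k)

*-distribˡ-minus : ∀ x a b → x * (a ℚ.- b) ≡ x * a ℚ.- x * b
*-distribˡ-minus = solve 3 (λ x a b → x :* (a :- b) := x :* a :- x :* b) refl

*-distribʳ-minus : ∀ a b x → (a ℚ.- b) * x ≡ a * x ℚ.- b * x
*-distribʳ-minus = solve 3 (λ a b x → (a :- b) :* x := a :* x :- b :* x) refl

+-minus-cancelʳ : ∀ a b → (a +ℚ b) ℚ.- b ≡ a
+-minus-cancelʳ = solve 2 (λ a b → (a :+ b) :- b := a) refl

sumℚ-cong : ∀ m {f g : ℕ → ℚ} → (∀ i → i < m → f i ≡ g i) → sumℚ m f ≡ sumℚ m g
sumℚ-cong zero    f≗g = refl
sumℚ-cong (suc m) f≗g = cong₂ _+ℚ_ (sumℚ-cong m (λ i i<m → f≗g i (ℕP.m<n⇒m<1+n i<m))) (f≗g m ℕP.≤-refl)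

sumℚ-distrib-+ : ∀ m (f g : ℕ → ℚ) → sumℚ m (λ i → f i +ℚ g i) ≡ sumℚ m f +ℚ sumℚ m g
sumℚ-distrib-+ zero    f g = refl
sumℚ-distrib-+ (suc m) f g =
  trans (cong (_+ℚ (f m +ℚ g m)) (sumℚ-distrib-+ m f g)) (swap (sumℚ m f) (sumℚ m g) (f m) (g m))
  where
  swap : ∀ a b c d → (a +ℚ b) +ℚ (c +ℚ d) ≡ (a +ℚ c) +ℚ (b +ℚ d)
  swap = solve 4 (λ a b c d → (a :+ b) :+ (c :+ d) := (a :+ c) :+ (b :+ d)) refl

*-distribˡ-sumℚ : ∀ m c (f : ℕ → ℚ) → c * sumℚ m f ≡ sumℚ m (λ i → c * f i)
*-distribˡ-sumℚ zero    c f = ℚP.*-zeroʳ c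
*-distribˡ-sumℚ (suc m) c f =
  trans (ℚP.*-distribˡ-+ c (sumℚ m f) (f m)) (cong (_+ℚ c * f m) (*-distribˡ-sumℚ m c f))

neg-distrib-sumℚ : ∀ m (f : ℕ → ℚ) → - sumℚ m f ≡ sumℚ m (λ i → - f i)
neg-distrib-sumℚ zero    f = refl
neg-distrib-sumℚ (suc m) f =
  trans (ℚP.neg-distrib-+ (sumℚ m f) (f m)) (cong (_+ℚ - f m) (neg-distrib-sumℚ m f))

sumℚ-distrib-minus : ∀ m (f g : ℕ → ℚ) → sumℚ m (λ i → f i ℚ.- g i) ≡ sumℚ m f ℚ.- sumℚ m g
sumℚ-distrib-minus m f g =
  trans (sumℚ-distrib-+ m f (-_ ∘ g)) (cong (sumℚ m f +ℚ_) (sym (neg-distrib-sumℚ m g)))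

sumℚ-head : ∀ m (f : ℕ → ℚ) → sumℚ (suc m) f ≡ f 0 +ℚ sumℚ m (f ∘ suc)
sumℚ-head zero    f = trans (ℚP.+-identityˡ (f 0)) (sym (ℚP.+-identityʳ (f 0)))
sumℚ-head (suc m) f = trans (cong (_+ℚ f (suc m)) (sumℚ-head m f)) (ℚP.+-assoc (f 0) _ _)

sumℚ-telescope : ∀ m (ψ : ℕ → ℚ) → sumℚ m (λ j → ψ j ℚ.- ψ (suc j)) ≡ ψ 0 ℚ.- ψ m
sumℚ-telescope zero    ψ = sym (ℚP.+-inverseʳ (ψ 0))
sumℚ-telescope (suc m) ψ =
  trans (cong (_+ℚ (ψ m ℚ.- ψ (suc m))) (sumℚ-telescope m ψ)) (cancel (ψ 0) (ψ m) (ψ (suc m)))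
  where
  cancel : ∀ a b c → (a ℚ.- b) +ℚ (b ℚ.- c) ≡ a ℚ.- c
  cancel = solve 3 (λ a b c → (a :- b) :+ (b :- c) := a :- c) refl

sumℚ-exchange : ∀ t (c f : ℕ → ℚ) →
  sumℚ t (λ k → c k * sumℚ (suc k) f) ≡ sumℚ (suc t) (λ j → (sumℚ t c ℚ.- sumℚ j c) * f j)
sumℚ-exchange zero    c f = sym (trans (ℚP.+-identityˡ _) (ℚP.*-zeroˡ (f 0)))
sumℚ-exchange (suc t) c f = begin
  sumℚ t (λ k → c k * sumℚ (suc k) f) +ℚ c t * sumℚ (suc t) f
    ≡⟨ cong₂ _+ℚ_ (sumℚ-exchange t c f) (*-distribˡ-sumℚ (suc t) (c t) f) ⟩
  sumℚ (suc t) (λ j → (S ℚ.- sumℚ j c) * f j) +ℚ sumℚ (suc t) (λ j → c t * f j)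
    ≡⟨ sumℚ-distrib-+ (suc t) _ _ ⟨
  sumℚ (suc t) (λ j → (S ℚ.- sumℚ j c) * f j +ℚ c t * f j)
    ≡⟨ sumℚ-cong (suc t) (λ j _ → merge S (sumℚ j c) (c t) (f j)) ⟩
  sumℚ (suc t) (λ j → (S +ℚ c t ℚ.- sumℚ j c) * f j)
    ≡⟨ ℚP.+-identityʳ _ ⟨
  sumℚ (suc t) (λ j → (S +ℚ c t ℚ.- sumℚ j c) * f j) +ℚ ℚ.0ℚ
    ≡⟨ cong (sumℚ (suc t) (λ j → (S +ℚ c t ℚ.- sumℚ j c) * f j) +ℚ_) (vanish (S +ℚ c t) (f (suc t))) ⟨
  sumℚ (suc (suc t)) (λ j → (S +ℚ c t ℚ.- sumℚ j c) * f j) ∎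
  where
  S = sumℚ t c
  merge : ∀ s a b x → (s ℚ.- a) * x +ℚ b * x ≡ (s +ℚ b ℚ.- a) * x
  merge = solve 4 (λ s a b x → (s :- a) :* x :+ b :* x := (s :+ b :- a) :* x) refl
  vanish : ∀ s x → (s ℚ.- s) * x ≡ ℚ.0ℚ
  vanish = solve 2 (λ s x → (s :- s) :* x := con ℚ.0ℚ) refl

/ℕ-unique : ∀ z d .{{_ : NonZero d}} k →
  k ℤ.* + d ℤ.≤ z → z ℤ.< ℤ.suc k ℤ.* + d → z ℤ./ℕ d ≡ k
/ℕ-unique z d k lo hi = ℤP.≤-antisym
  (below (ℤP.*-cancelʳ-<-nonNeg (+ d) (ℤP.≤-<-trans ([n/ℕd]*d≤n z d) hi)))
  (below (ℤP.*-cancelʳ-<-nonNeg (+ d) (ℤP.≤-<-trans lo (n<s[n/ℕd]*d z d))))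
  where
  below : ∀ {i j} → i ℤ.< ℤ.suc j → i ℤ.≤ j
  below {j = j} i<1+j = subst (_ ℤ.≤_) (ℤP.pred-suc j) (ℤP.i<j⇒i≤pred[j] i<1+j)

/ℕ-nonpos : ∀ z d .{{_ : NonZero d}} → z ℤ.< + d → z ℤ./ℕ d ℤ.≤ + 0
/ℕ-nonpos z d z<d = ℤP.i<j⇒i≤pred[j] (ℤP.*-cancelʳ-<-nonNeg {j = + 1} (+ d)
  (ℤP.≤-<-trans ([n/ℕd]*d≤n z d) (subst (z ℤ.<_) (sym (ℤP.*-identityˡ (+ d))) z<d)))

/ℕ-+d : ∀ z d .{{_ : NonZero d}} → (+ d ℤ.+ z) ℤ./ℕ d ≡ ℤ.suc (z ℤ./ℕ d)
/ℕ-+d z d = /ℕ-unique (+ d ℤ.+ z) d (ℤ.suc q)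
  (subst (ℤ._≤ + d ℤ.+ z) (sym (ℤP.suc-* q (+ d))) (ℤP.+-monoʳ-≤ (+ d) ([n/ℕd]*d≤n z d)))
  (subst (+ d ℤ.+ z ℤ.<_) (sym (ℤP.suc-* (ℤ.suc q) (+ d))) (ℤP.+-monoʳ-< (+ d) (n<s[n/ℕd]*d z d)))
  where q = z ℤ./ℕ d

%ℕ-+d : ∀ z d .{{_ : NonZero d}} → (+ d ℤ.+ z) ℤ.%ℕ d ≡ z ℤ.%ℕ d
%ℕ-+d z d = ℤP.+-injective (begin
  + r′                                              ≡⟨ cancel (+ r′) q (+ d) ⟨
  (+ r′ ℤ.+ (+ 1 ℤ.+ q) ℤ.* + d) - (+ 1 ℤ.+ q) ℤ.* + d
    ≡⟨ cong (λ w → + r′ ℤ.+ w ℤ.* + d - (+ 1 ℤ.+ q) ℤ.* + d) (/ℕ-+d z d) ⟨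
  (+ r′ ℤ.+ q′ ℤ.* + d) - (+ 1 ℤ.+ q) ℤ.* + d
    ≡⟨ cong (_- (+ 1 ℤ.+ q) ℤ.* + d) (a≡a%ℕn+[a/ℕn]*n (+ d ℤ.+ z) d) ⟨
  (+ d ℤ.+ z) - (+ 1 ℤ.+ q) ℤ.* + d
    ≡⟨ cong (λ w → (+ d ℤ.+ w) - (+ 1 ℤ.+ q) ℤ.* + d) (a≡a%ℕn+[a/ℕn]*n z d) ⟩
  (+ d ℤ.+ (+ r ℤ.+ q ℤ.* + d)) - (+ 1 ℤ.+ q) ℤ.* + d ≡⟨ shift (+ r) q (+ d) ⟩
  + r                                               ∎)
  where
  q = z ℤ./ℕ d
  r = z ℤ.%ℕ d
  q′ = (+ d ℤ.+ z) ℤ./ℕ d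
  r′ = (+ d ℤ.+ z) ℤ.%ℕ d
  cancel : ∀ r q d → (r ℤ.+ (+ 1 ℤ.+ q) ℤ.* d) - (+ 1 ℤ.+ q) ℤ.* d ≡ r
  cancel = solve-∀
  shift : ∀ r q d → (d ℤ.+ (r ℤ.+ q ℤ.* d)) - (+ 1 ℤ.+ q) ℤ.* d ≡ r
  shift = solve-∀

-- Binomial coefficients with alternating signs

[1+k]*nC[1+k]≡[n-k]*nCk : ∀ n k → + suc k ℤ.* + (n C suc k) ≡ (+ n - + k) ℤ.* + (n C k)
[1+k]*nC[1+k]≡[n-k]*nCk zero    zero    = refl
[1+k]*nC[1+k]≡[n-k]*nCk zero    (suc k) = trans (ℤP.*-zeroʳ (+ suc (suc k))) (sym (ℤP.*-zeroʳ (+ 0 - + suc k)))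
[1+k]*nC[1+k]≡[n-k]*nCk (suc n) zero    = begin
  + 1 ℤ.* + (suc n C 1) ≡⟨ ℤP.*-identityˡ _ ⟩
  + (suc n C 1)         ≡⟨ cong +_ (nC1≡n (suc n)) ⟩
  + suc n               ≡⟨ ℤP.+-identityʳ (+ suc n) ⟨
  + suc n - + 0         ≡⟨ ℤP.*-identityʳ (+ suc n - + 0) ⟨
  (+ suc n - + 0) ℤ.* + 1 ∎
[1+k]*nC[1+k]≡[n-k]*nCk (suc n) (suc k) = begin
  + suc (suc k) ℤ.* + (suc n C suc (suc k))
    ≡⟨ cong (λ c → + suc (suc k) ℤ.* + c) (nCk+nC[k+1]≡[n+1]C[k+1] n (suc k)) ⟨
  + suc (suc k) ℤ.* + (A ℕ.+ B)
    ≡⟨ cong (+ suc (suc k) ℤ.*_) (ℤP.pos-+ A B) ⟩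
  + suc (suc k) ℤ.* (+ A ℤ.+ + B)
    ≡⟨ regroup (+ k) (+ A) (+ B) ⟩
  + suc (suc k) ℤ.* + B ℤ.+ + suc k ℤ.* + A ℤ.+ + A
    ≡⟨ cong₂ (λ u v → u ℤ.+ v ℤ.+ + A) ([1+k]*nC[1+k]≡[n-k]*nCk n (suc k)) ([1+k]*nC[1+k]≡[n-k]*nCk n k) ⟩
  (+ n - + suc k) ℤ.* + A ℤ.+ (+ n - + k) ℤ.* + C₀ ℤ.+ + A
    ≡⟨ collect (+ n) (+ k) (+ A) (+ C₀) ⟩
  (+ suc n - + suc k) ℤ.* (+ C₀ ℤ.+ + A)
    ≡⟨ cong ((+ suc n - + suc k) ℤ.*_)
         (trans (sym (ℤP.pos-+ C₀ A)) (cong +_ (nCk+nC[k+1]≡[n+1]C[k+1] n k))) ⟩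
  (+ suc n - + suc k) ℤ.* + (suc n C suc k) ∎
  where
  A = n C suc k
  B = n C suc (suc k)
  C₀ = n C k
  regroup : ∀ k a b → (+ 2 ℤ.+ k) ℤ.* (a ℤ.+ b) ≡ (+ 2 ℤ.+ k) ℤ.* b ℤ.+ (+ 1 ℤ.+ k) ℤ.* a ℤ.+ a
  regroup = solve-∀
  collect : ∀ n k a c →
    (n - (+ 1 ℤ.+ k)) ℤ.* a ℤ.+ (n - k) ℤ.* c ℤ.+ a ≡ ((+ 1 ℤ.+ n) - (+ 1 ℤ.+ k)) ℤ.* (c ℤ.+ a)
  collect = solve-∀

signedBinom : ℕ → ℕ → ℚ
signedBinom t i = toℚ (+ (t C i) ℤ.* (-1ℤ ℤ.^ i))

signedBinom-vanishes : ∀ t → signedBinom t (suc t) ≡ ℚ.0ℚ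
signedBinom-vanishes t = cong (λ c → toℚ (+ c ℤ.* (-1ℤ ℤ.^ suc t))) (k>n⇒nCk≡0 (ℕP.n<1+n t))

signedBinom-pascal : ∀ t i → signedBinom (suc t) (suc i) ≡ signedBinom t (suc i) ℚ.- signedBinom t i
signedBinom-pascal t i = trans (cong toℚ (begin
  + (suc t C suc i) ℤ.* (-1ℤ ℤ.* s)
    ≡⟨ cong (λ c → + c ℤ.* (-1ℤ ℤ.* s)) (nCk+nC[k+1]≡[n+1]C[k+1] t i) ⟨
  + (t C i ℕ.+ t C suc i) ℤ.* (-1ℤ ℤ.* s)
    ≡⟨ cong (ℤ._* (-1ℤ ℤ.* s)) (ℤP.pos-+ (t C i) (t C suc i)) ⟩
  (+ (t C i) ℤ.+ + (t C suc i)) ℤ.* (-1ℤ ℤ.* s)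
    ≡⟨ split (+ (t C i)) (+ (t C suc i)) s ⟩
  + (t C suc i) ℤ.* (-1ℤ ℤ.* s) - + (t C i) ℤ.* s ∎))
  (toℚ-homo-minus (+ (t C suc i) ℤ.* (-1ℤ ℤ.* s)) (+ (t C i) ℤ.* s))
  where
  s = -1ℤ ℤ.^ i
  split : ∀ a b s → (a ℤ.+ b) ℤ.* (-1ℤ ℤ.* s) ≡ b ℤ.* (-1ℤ ℤ.* s) - a ℤ.* s
  split = solve-∀

signedBinom-suc : ∀ t i →
  signedBinom t (suc i) ≡ signedBinom t i ℚ.- toℚ (+ suc t) * (1/[1+ i ] * signedBinom t i)
signedBinom-suc t i = *-cancelʳ-toℚ (suc i) (begin
  signedBinom t (suc i) * toℚ (+ suc i)
    ≡⟨ toℚ-homo-* (+ (t C suc i) ℤ.* (-1ℤ ℤ.* s)) (+ suc i) ⟨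
  toℚ (+ (t C suc i) ℤ.* (-1ℤ ℤ.* s) ℤ.* + suc i)
    ≡⟨ cong toℚ (begin
         + (t C suc i) ℤ.* (-1ℤ ℤ.* s) ℤ.* + suc i ≡⟨ reorder (+ (t C suc i)) s (+ suc i) ⟩
         -1ℤ ℤ.* s ℤ.* (+ suc i ℤ.* + (t C suc i)) ≡⟨ cong (-1ℤ ℤ.* s ℤ.*_) ([1+k]*nC[1+k]≡[n-k]*nCk t i) ⟩
         -1ℤ ℤ.* s ℤ.* ((+ t - + i) ℤ.* + (t C i)) ≡⟨ flip (+ t) (+ i) (+ (t C i)) s ⟩
         (+ i - + t) ℤ.* (+ (t C i) ℤ.* s)         ∎) ⟩
  toℚ ((+ i - + t) ℤ.* (+ (t C i) ℤ.* s))
    ≡⟨ trans (toℚ-homo-* (+ i - + t) (+ (t C i) ℤ.* s)) (cong (_* β) (toℚ-homo-minus (+ i) (+ t))) ⟩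
  (I ℚ.- T) * β
    ≡⟨ expand I T β ⟩
  β * (ℚ.1ℚ +ℚ I) ℚ.- (ℚ.1ℚ +ℚ T) * β * ℚ.1ℚ
    ≡⟨ cong (λ w → β * (ℚ.1ℚ +ℚ I) ℚ.- (ℚ.1ℚ +ℚ T) * β * w) u*[1+I]≡1 ⟨
  β * (ℚ.1ℚ +ℚ I) ℚ.- (ℚ.1ℚ +ℚ T) * β * (u * (ℚ.1ℚ +ℚ I))
    ≡⟨ factor β T u (ℚ.1ℚ +ℚ I) ⟩
  (β ℚ.- (ℚ.1ℚ +ℚ T) * (u * β)) * (ℚ.1ℚ +ℚ I)
    ≡⟨ cong₂ (λ a b → (β ℚ.- a * (u * β)) * b) (toℚ-homo-+ (+ 1) (+ t)) (toℚ-homo-+ (+ 1) (+ i)) ⟨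
  (β ℚ.- toℚ (+ suc t) * (u * β)) * toℚ (+ suc i) ∎)
  where
  s = -1ℤ ℤ.^ i
  β = signedBinom t i
  u = 1/[1+ i ]
  I = toℚ (+ i)
  T = toℚ (+ t)
  u*[1+I]≡1 : u * (ℚ.1ℚ +ℚ I) ≡ ℚ.1ℚ
  u*[1+I]≡1 = trans (cong (u *_) (sym (toℚ-homo-+ (+ 1) (+ i)))) (1/[1+k]*[1+k]≡1 i)
  reorder : ∀ c s j → c ℤ.* (-1ℤ ℤ.* s) ℤ.* j ≡ -1ℤ ℤ.* s ℤ.* (j ℤ.* c)
  reorder = solve-∀
  flip : ∀ t i c s → -1ℤ ℤ.* s ℤ.* ((t - i) ℤ.* c) ≡ (i - t) ℤ.* (c ℤ.* s)
  flip = solve-∀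
  expand : ∀ I T b → (I ℚ.- T) * b ≡ b * (ℚ.1ℚ +ℚ I) ℚ.- (ℚ.1ℚ +ℚ T) * b * ℚ.1ℚ
  expand = solve 3 (λ I T b → (I :- T) :* b := b :* (con ℚ.1ℚ :+ I) :- (con ℚ.1ℚ :+ T) :* b :* con ℚ.1ℚ) refl
  factor : ∀ b T u j → b * j ℚ.- (ℚ.1ℚ +ℚ T) * b * (u * j) ≡ (b ℚ.- (ℚ.1ℚ +ℚ T) * (u * b)) * j
  factor = solve 4 (λ b T u j →
    b :* j :- (con ℚ.1ℚ :+ T) :* b :* (u :* j) := (b :- (con ℚ.1ℚ :+ T) :* (u :* b)) :* j) refl

sumℚ-signedBinom-suc : ∀ t (φ : ℕ → ℚ) →
  sumℚ (suc (suc t)) (λ i → signedBinom (suc t) i * φ i)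
    ≡ sumℚ (suc t) (λ i → signedBinom t i * (φ i ℚ.- φ (suc i)))
sumℚ-signedBinom-suc t φ = begin
  sumℚ (suc (suc t)) (λ i → signedBinom (suc t) i * φ i)
    ≡⟨ sumℚ-head (suc t) _ ⟩
  ℚ.1ℚ * φ 0 +ℚ sumℚ (suc t) (λ i → signedBinom (suc t) (suc i) * φ (suc i))
    ≡⟨ cong (ℚ.1ℚ * φ 0 +ℚ_) (trans (sumℚ-cong (suc t) (λ i _ →
         trans (cong (_* φ (suc i)) (signedBinom-pascal t i))
               (*-distribʳ-minus (signedBinom t (suc i)) (signedBinom t i) (φ (suc i)))))
         (sumℚ-distrib-minus (suc t) _ _)) ⟩
  ℚ.1ℚ * φ 0 +ℚ (A ℚ.- B)
    ≡⟨ ℚP.+-assoc (ℚ.1ℚ * φ 0) A (- B) ⟨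
  (ℚ.1ℚ * φ 0 +ℚ A) ℚ.- B
    ≡⟨ cong (ℚ._- B) (sumℚ-head (suc t) (λ i → signedBinom t i * φ i)) ⟨
  (S +ℚ signedBinom t (suc t) * φ (suc t)) ℚ.- B
    ≡⟨ cong (λ w → (S +ℚ w * φ (suc t)) ℚ.- B) (signedBinom-vanishes t) ⟩
  (S +ℚ ℚ.0ℚ * φ (suc t)) ℚ.- B
    ≡⟨ cong (ℚ._- B) (trans (cong (S +ℚ_) (ℚP.*-zeroˡ (φ (suc t)))) (ℚP.+-identityʳ S)) ⟩
  S ℚ.- B
    ≡⟨ sumℚ-distrib-minus (suc t) _ _ ⟨
  sumℚ (suc t) (λ i → signedBinom t i * φ i ℚ.- signedBinom t i * φ (suc i))
    ≡⟨ sumℚ-cong (suc t) (λ i _ → *-distribˡ-minus (signedBinom t i) (φ i) (φ (suc i))) ⟨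
  sumℚ (suc t) (λ i → signedBinom t i * (φ i ℚ.- φ (suc i))) ∎
  where
  A = sumℚ (suc t) (λ i → signedBinom t (suc i) * φ (suc i))
  B = sumℚ (suc t) (λ i → signedBinom t i * φ (suc i))
  S = sumℚ (suc t) (λ i → signedBinom t i * φ i)

harmonic : ℕ → ℚ
harmonic i = sumℚ i 1/[1+_]

signedBinomDefect : ℕ → ℕ → ℚ
signedBinomDefect t i = sumℚ i (λ k → 1/[1+ k ] * signedBinom t k)

signedBinom≡1-[1+t]*defect : ∀ t i →
  signedBinom t i ≡ ℚ.1ℚ ℚ.- toℚ (+ suc t) * signedBinomDefect t i
signedBinom≡1-[1+t]*defect t zero    = sym (unit (toℚ (+ suc t)))
  where
  unit : ∀ T → ℚ.1ℚ ℚ.- T * ℚ.0ℚ ≡ ℚ.1ℚ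
  unit = solve 1 (λ T → con ℚ.1ℚ :- T :* con ℚ.0ℚ := con ℚ.1ℚ) refl
signedBinom≡1-[1+t]*defect t (suc i) = begin
  signedBinom t (suc i)
    ≡⟨ signedBinom-suc t i ⟩
  β ℚ.- T * (1/[1+ i ] * β)
    ≡⟨ cong (λ w → w ℚ.- T * (1/[1+ i ] * β)) (signedBinom≡1-[1+t]*defect t i) ⟩
  (ℚ.1ℚ ℚ.- T * signedBinomDefect t i) ℚ.- T * (1/[1+ i ] * β)
    ≡⟨ collect T (signedBinomDefect t i) (1/[1+ i ] * β) ⟩
  ℚ.1ℚ ℚ.- T * signedBinomDefect t (suc i) ∎
  where
  β = signedBinom t i
  T = toℚ (+ suc t)
  collect : ∀ T d x → (ℚ.1ℚ ℚ.- T * d) ℚ.- T * x ≡ ℚ.1ℚ ℚ.- T * (d +ℚ x)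
  collect = solve 3 (λ T d x → (con ℚ.1ℚ :- T :* d) :- T :* x := con ℚ.1ℚ :- T :* (d :+ x)) refl

signedBinomDefect-harmonic : ∀ t i → signedBinomDefect t i
  ≡ harmonic i ℚ.- toℚ (+ suc t) * sumℚ i (λ k → 1/[1+ k ] * signedBinomDefect t k)
signedBinomDefect-harmonic t i = begin
  sumℚ i (λ k → 1/[1+ k ] * signedBinom t k)
    ≡⟨ sumℚ-cong i (λ k _ → trans (cong (1/[1+ k ] *_) (signedBinom≡1-[1+t]*defect t k))
                                  (expand 1/[1+ k ] T (signedBinomDefect t k))) ⟩
  sumℚ i (λ k → 1/[1+ k ] ℚ.- T * (1/[1+ k ] * signedBinomDefect t k))
    ≡⟨ sumℚ-distrib-minus i _ _ ⟩
  harmonic i ℚ.- sumℚ i (λ k → T * (1/[1+ k ] * signedBinomDefect t k))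
    ≡⟨ cong (ℚ._-_ (harmonic i)) (*-distribˡ-sumℚ i T _) ⟨
  harmonic i ℚ.- T * sumℚ i (λ k → 1/[1+ k ] * signedBinomDefect t k) ∎
  where
  T = toℚ (+ suc t)
  expand : ∀ u T d → u * (ℚ.1ℚ ℚ.- T * d) ≡ u ℚ.- T * (u * d)
  expand = solve 3 (λ u T d → u :* (con ℚ.1ℚ :- T :* d) := u :- T :* (u :* d)) refl

gbinom-absorb : ∀ x l → gbinom x (suc l) * toℚ (+ suc l) ≡ gbinom x l * toℚ (x - + l)
gbinom-absorb x l = trans (ℚP.*-assoc (gbinom x l) _ _) (cong (gbinom x l *_) (i/n*n≡i (x - + l) (suc l)))

gbinom-0 : ∀ l → gbinom (+ 0) (suc l) ≡ ℚ.0ℚ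
gbinom-0 zero    = refl
gbinom-0 (suc l) = trans (cong (_* ((+ 0 - + suc l) / suc (suc l))) (gbinom-0 l)) (ℚP.*-zeroˡ ((+ 0 - + suc l) / suc (suc l)))

toℚ-suc-split : ∀ x l → toℚ (ℤ.suc x) ≡ toℚ (x - + l) +ℚ toℚ (+ suc l)
toℚ-suc-split x l = trans (cong toℚ (regroup x (+ l))) (toℚ-homo-+ (x - + l) (+ suc l))
  where
  regroup : ∀ x l → + 1 ℤ.+ x ≡ (x - l) ℤ.+ (+ 1 ℤ.+ l)
  regroup = solve-∀

mutual
  gbinom-pascal : ∀ x l → gbinom (ℤ.suc x) (suc l) ≡ gbinom x (suc l) +ℚ gbinom x l
  gbinom-pascal x l = *-cancelʳ-toℚ (suc l) (begin
    gbinom (ℤ.suc x) (suc l) * toℚ (+ suc l)           ≡⟨ gbinom-absorb (ℤ.suc x) l ⟩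
    gbinom (ℤ.suc x) l * toℚ (ℤ.suc x - + l)           ≡⟨ gbinom-suc-* x l ⟩
    G * toℚ (ℤ.suc x)                                  ≡⟨ cong (G *_) (toℚ-suc-split x l) ⟩
    G * (toℚ (x - + l) +ℚ toℚ (+ suc l))               ≡⟨ ℚP.*-distribˡ-+ G _ _ ⟩
    G * toℚ (x - + l) +ℚ G * toℚ (+ suc l)             ≡⟨ cong (_+ℚ G * toℚ (+ suc l)) (gbinom-absorb x l) ⟨
    G₁ * toℚ (+ suc l) +ℚ G * toℚ (+ suc l)            ≡⟨ ℚP.*-distribʳ-+ (toℚ (+ suc l)) G₁ G ⟨
    (G₁ +ℚ G) * toℚ (+ suc l)                          ∎)
    where
    G₁ = gbinom x (suc l)
    G = gbinom x l

  gbinom-suc-* : ∀ x l → gbinom (ℤ.suc x) l * toℚ (ℤ.suc x - + l) ≡ gbinom x l * toℚ (ℤ.suc x)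
  gbinom-suc-* x zero    = cong (λ z → ℚ.1ℚ * toℚ z) (ℤP.+-identityʳ (ℤ.suc x))
  gbinom-suc-* x (suc l) = begin
    gbinom (ℤ.suc x) (suc l) * toℚ (ℤ.suc x - + suc l)
      ≡⟨ cong₂ _*_ (gbinom-pascal x l) (cong toℚ (cancel x (+ l))) ⟩
    (G₁ +ℚ G₀) * toℚ (x - + l)                 ≡⟨ ℚP.*-distribʳ-+ (toℚ (x - + l)) G₁ G₀ ⟩
    G₁ * toℚ (x - + l) +ℚ G₀ * toℚ (x - + l)   ≡⟨ cong (G₁ * toℚ (x - + l) +ℚ_) (gbinom-absorb x l) ⟨
    G₁ * toℚ (x - + l) +ℚ G₁ * toℚ (+ suc l)   ≡⟨ ℚP.*-distribˡ-+ G₁ _ _ ⟨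
    G₁ * (toℚ (x - + l) +ℚ toℚ (+ suc l))      ≡⟨ cong (G₁ *_) (toℚ-suc-split x l) ⟨
    G₁ * toℚ (ℤ.suc x)                         ∎
    where
    G₁ = gbinom x (suc l)
    G₀ = gbinom x l
    cancel : ∀ x l → (+ 1 ℤ.+ x) - (+ 1 ℤ.+ l) ≡ x - l
    cancel = solve-∀

gbinom-pascal′ : ∀ x l → gbinom x (suc l) ≡ gbinom (ℤ.suc x) (suc l) ℚ.- gbinom x l
gbinom-pascal′ x l =
  sym (trans (cong (ℚ._- gbinom x l) (gbinom-pascal x l)) (+-minus-cancelʳ (gbinom x (suc l)) (gbinom x l)))

-- Rationals without p in the denominator

record IsPIntegral (p : ℕ) (x : ℚ) : Set where
  constructor pIntegral
  field
    denominator            : ℕ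
    p∤denominator          : ¬ p ∣ denominator
    numerator              : ℤ
    *denominator≡numerator : x * toℚ (+ denominator) ≡ toℚ numerator

numerator-coprime : ∀ x → Coprimality.Coprime ℤ.∣ ℚ.↥ x ∣ (ℚ.↧ₙ x)
numerator-coprime (ℚ.mkℚ _ _ c) = Coprimality.recompute c

module PIntegral {p : ℕ} (isPrime : Prime p) where

  p≢1 : p ≢ 1
  p≢1 refl = ¬prime[1] isPrime

  p∤1 : ¬ p ∣ 1
  p∤1 = p≢1 ∘ ∣1⇒≡1

  p∤* : ∀ {a b} → ¬ p ∣ a → ¬ p ∣ b → ¬ p ∣ a ℕ.* b
  p∤* {a} {b} p∤a p∤b p∣ab = [ p∤a , p∤b ]′ (euclidsLemma a b isPrime p∣ab)

  isPIntegral-cong : ∀ {x y} → x ≡ y → IsPIntegral p x → IsPIntegral p y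
  isPIntegral-cong refl x∈ℤₚ = x∈ℤₚ

  isPIntegral-toℚ : ∀ a → IsPIntegral p (toℚ a)
  isPIntegral-toℚ a = pIntegral 1 p∤1 a (ℚP.*-identityʳ (toℚ a))

  isPIntegral-0 : IsPIntegral p ℚ.0ℚ
  isPIntegral-0 = isPIntegral-toℚ (+ 0)

  isPIntegral-1/[1+k] : ∀ k → ¬ p ∣ suc k → IsPIntegral p 1/[1+ k ]
  isPIntegral-1/[1+k] k p∤1+k = pIntegral (suc k) p∤1+k (+ 1) (1/[1+k]*[1+k]≡1 k)

  isPIntegral-neg : ∀ {x} → IsPIntegral p x → IsPIntegral p (- x)
  isPIntegral-neg {x} (pIntegral b p∤b a xb≡a) = pIntegral b p∤b (ℤ.- a)
    (trans (sym (ℚP.neg-distribˡ-* x (toℚ (+ b)))) (trans (cong -_ xb≡a) (sym (toℚ-homo‿- a))))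

  isPIntegral-+ : ∀ {x y} → IsPIntegral p x → IsPIntegral p y → IsPIntegral p (x +ℚ y)
  isPIntegral-+ {x} {y} (pIntegral b p∤b a xb≡a) (pIntegral d p∤d c yd≡c) =
    pIntegral (b ℕ.* d) (p∤* p∤b p∤d) (a ℤ.* + d ℤ.+ c ℤ.* + b) (begin
      (x +ℚ y) * toℚ (+ (b ℕ.* d))           ≡⟨ cong ((x +ℚ y) *_) (toℚ-pos-* b d) ⟩
      (x +ℚ y) * (B * D)                     ≡⟨ cross x y B D ⟩
      x * B * D +ℚ y * D * B                 ≡⟨ cong₂ (λ u v → u * D +ℚ v * B) xb≡a yd≡c ⟩
      toℚ a * D +ℚ toℚ c * B                 ≡⟨ cong₂ _+ℚ_ (toℚ-homo-* a (+ d)) (toℚ-homo-* c (+ b)) ⟨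
      toℚ (a ℤ.* + d) +ℚ toℚ (c ℤ.* + b)     ≡⟨ toℚ-homo-+ (a ℤ.* + d) (c ℤ.* + b) ⟨
      toℚ (a ℤ.* + d ℤ.+ c ℤ.* + b)          ∎)
    where
    B = toℚ (+ b)
    D = toℚ (+ d)
    cross : ∀ x y u v → (x +ℚ y) * (u * v) ≡ x * u * v +ℚ y * v * u
    cross = solve 4 (λ x y u v → (x :+ y) :* (u :* v) := x :* u :* v :+ y :* v :* u) refl

  isPIntegral-* : ∀ {x y} → IsPIntegral p x → IsPIntegral p y → IsPIntegral p (x * y)
  isPIntegral-* {x} {y} (pIntegral b p∤b a xb≡a) (pIntegral d p∤d c yd≡c) =
    pIntegral (b ℕ.* d) (p∤* p∤b p∤d) (a ℤ.* c) (begin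
      x * y * toℚ (+ (b ℕ.* d))  ≡⟨ cong (x * y *_) (toℚ-pos-* b d) ⟩
      x * y * (B * D)            ≡⟨ interchange x y B D ⟩
      (x * B) * (y * D)          ≡⟨ cong₂ _*_ xb≡a yd≡c ⟩
      toℚ a * toℚ c              ≡⟨ toℚ-homo-* a c ⟨
      toℚ (a ℤ.* c)              ∎)
    where
    B = toℚ (+ b)
    D = toℚ (+ d)
    interchange : ∀ x y u v → x * y * (u * v) ≡ (x * u) * (y * v)
    interchange = solve 4 (λ x y u v → x :* y :* (u :* v) := (x :* u) :* (y :* v)) refl

  isPIntegral-minus : ∀ {x y} → IsPIntegral p x → IsPIntegral p y → IsPIntegral p (x ℚ.- y)
  isPIntegral-minus x∈ℤₚ y∈ℤₚ = isPIntegral-+ x∈ℤₚ (isPIntegral-neg y∈ℤₚ)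

  isPIntegral-sumℚ : ∀ m {f : ℕ → ℚ} → (∀ i → i < m → IsPIntegral p (f i)) → IsPIntegral p (sumℚ m f)
  isPIntegral-sumℚ zero    f∈ℤₚ = isPIntegral-0
  isPIntegral-sumℚ (suc m) f∈ℤₚ =
    isPIntegral-+ (isPIntegral-sumℚ m (λ i i<m → f∈ℤₚ i (ℕP.m<n⇒m<1+n i<m))) (f∈ℤₚ m ℕP.≤-refl)

  isPIntegral⇒isPAdicInt : ∀ {x} → IsPIntegral p x → IsPAdicInt p x
  isPIntegral⇒isPAdicInt {x} (pIntegral b p∤b a xb≡a) p∣↧x =
    [ p∤↥x , p∤b ]′ (euclidsLemma ℤ.∣ ℚ.↥ x ∣ b isPrime p∣↥x*b)
    where
    x↧≡↥ : x * toℚ (+ ℚ.↧ₙ x) ≡ toℚ (ℚ.↥ x)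
    x↧≡↥ = trans (cong (_* toℚ (+ ℚ.↧ₙ x)) (sym (ℚP.↥p/↧p≡p x))) (i/n*n≡i (ℚ.↥ x) (ℚ.↧ₙ x))
    ↥x*b≡a*↧x : ℚ.↥ x ℤ.* + b ≡ a ℤ.* + ℚ.↧ₙ x
    ↥x*b≡a*↧x = toℚ-injective (begin
      toℚ (ℚ.↥ x ℤ.* + b)                 ≡⟨ toℚ-homo-* (ℚ.↥ x) (+ b) ⟩
      toℚ (ℚ.↥ x) * toℚ (+ b)             ≡⟨ cong (_* toℚ (+ b)) x↧≡↥ ⟨
      x * toℚ (+ ℚ.↧ₙ x) * toℚ (+ b)      ≡⟨ swap x (toℚ (+ ℚ.↧ₙ x)) (toℚ (+ b)) ⟩
      x * toℚ (+ b) * toℚ (+ ℚ.↧ₙ x)      ≡⟨ cong (_* toℚ (+ ℚ.↧ₙ x)) xb≡a ⟩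
      toℚ a * toℚ (+ ℚ.↧ₙ x)              ≡⟨ toℚ-homo-* a (+ ℚ.↧ₙ x) ⟨
      toℚ (a ℤ.* + ℚ.↧ₙ x)                ∎)
      where
      swap : ∀ x u v → x * u * v ≡ x * v * u
      swap = solve 3 (λ x u v → x :* u :* v := x :* v :* u) refl
    p∣↥x*b : p ∣ ℤ.∣ ℚ.↥ x ∣ ℕ.* b
    p∣↥x*b = subst (p ∣_)
      (sym (trans (sym (ℤP.abs-* (ℚ.↥ x) (+ b)))
                  (trans (cong ℤ.∣_∣ ↥x*b≡a*↧x) (ℤP.abs-* a (+ ℚ.↧ₙ x)))))
      (∣n⇒∣m*n ℤ.∣ a ∣ p∣↧x)
    p∤↥x : ¬ p ∣ ℤ.∣ ℚ.↥ x ∣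
    p∤↥x p∣↥x = p≢1 (numerator-coprime x (p∣↥x , p∣↧x))

  isPIntegral-gbinom : ∀ x l → IsPIntegral p (gbinom x l)
  isPIntegral-gbinom x          zero    = isPIntegral-toℚ (+ 1)
  isPIntegral-gbinom (+ zero)   (suc l) = isPIntegral-cong (sym (gbinom-0 l)) isPIntegral-0
  isPIntegral-gbinom (+ suc m)  (suc l) = isPIntegral-cong (sym (gbinom-pascal (+ m) l))
    (isPIntegral-+ (isPIntegral-gbinom (+ m) (suc l)) (isPIntegral-gbinom (+ m) l))
  isPIntegral-gbinom -[1+ zero ]  (suc l) = isPIntegral-cong (sym (gbinom-pascal′ -[1+ 0 ] l))
    (isPIntegral-minus (isPIntegral-gbinom (+ 0) (suc l)) (isPIntegral-gbinom -[1+ 0 ] l))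
  isPIntegral-gbinom -[1+ suc m ] (suc l) = isPIntegral-cong (sym (gbinom-pascal′ -[1+ suc m ] l))
    (isPIntegral-minus (isPIntegral-gbinom -[1+ m ] (suc l)) (isPIntegral-gbinom -[1+ suc m ] l))

-- The defining sums and the powers of -p

module FProperties (q : ℕ) where

  p : ℕ
  p = suc (suc q)

  quotientBinom : ℕ → ℤ → ℚ
  quotientBinom l z with z ℤ.%ℕ p
  ... | zero  = gbinom (z ℤ./ℕ p) l
  ... | suc _ = ℚ.0ℚ

  -- The summand of FSum is local to its definition, so the left-hand side of
  -- FSum-summand is found by unification from its use in FSum≡sumℚ-signedBinom.
  mutual
    FSum≡sumℚ-signedBinom : ∀ l n r →
      FSum q l n r ≡ sumℚ (suc n) (λ k → signedBinom n k * quotientBinom l (+ k - r))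
    FSum≡sumℚ-signedBinom l n r = sumℚ-cong (suc n) (λ k _ → FSum-summand l n r k)

    FSum-summand : ∀ l n r k → _ ≡ signedBinom n k * quotientBinom l (+ k - r)
    FSum-summand l n r k with (+ k - r) ℤ.%ℕ p
    ... | zero  = refl
    ... | suc _ = sym (ℚP.*-zeroʳ (signedBinom n k))

  quotientBinom-+p : ∀ l z → quotientBinom (suc l) (+ p ℤ.+ z) ≡ quotientBinom (suc l) z +ℚ quotientBinom l z
  quotientBinom-+p l z rewrite %ℕ-+d z p {{_}} with z ℤ.%ℕ p
  ... | zero  = trans (cong (λ w → gbinom w (suc l)) (/ℕ-+d z p)) (gbinom-pascal (z ℤ./ℕ p) l)
  ... | suc _ = refl

  quotientBinom₀-+p : ∀ z → quotientBinom 0 (+ p ℤ.+ z) ≡ quotientBinom 0 z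
  quotientBinom₀-+p z rewrite %ℕ-+d z p {{_}} with z ℤ.%ℕ p
  ... | zero  = refl
  ... | suc _ = refl

  lowerSum : ℕ → ℕ → ℤ → ℚ
  lowerSum zero    m r = ℚ.0ℚ
  lowerSum (suc l) m r = FSum q l m r

  FSum-shifted : ∀ l m s {g : ℤ → ℚ} → (∀ z → quotientBinom l (+ p ℤ.+ z) ≡ g z) →
    FSum q l m (s - + p) ≡ sumℚ (suc m) (λ k → signedBinom m k * g (+ k - s))
  FSum-shifted l m s shift-by-p = trans (FSum≡sumℚ-signedBinom l m (s - + p))
    (sumℚ-cong (suc m) (λ k _ → cong (signedBinom m k *_)
      (trans (cong (quotientBinom l) (regroup (+ k) s (+ p))) (shift-by-p (+ k - s)))))
    where
    regroup : ∀ k s p → k - (s - p) ≡ p ℤ.+ (k - s)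
    regroup = solve-∀

  FSum-+p : ∀ l m s → FSum q l m (s - + p) ≡ FSum q l m s +ℚ lowerSum l m s
  FSum-+p zero    m s = trans (FSum-shifted 0 m s quotientBinom₀-+p)
    (trans (sym (FSum≡sumℚ-signedBinom 0 m s)) (sym (ℚP.+-identityʳ (FSum q 0 m s))))
  FSum-+p (suc l) m s = begin
    FSum q (suc l) m (s - + p)
      ≡⟨ FSum-shifted (suc l) m s (quotientBinom-+p l) ⟩
    sumℚ (suc m) (λ k → β k * (φ (suc l) k +ℚ φ l k))
      ≡⟨ sumℚ-cong (suc m) (λ k _ → ℚP.*-distribˡ-+ (β k) (φ (suc l) k) (φ l k)) ⟩
    sumℚ (suc m) (λ k → β k * φ (suc l) k +ℚ β k * φ l k)
      ≡⟨ sumℚ-distrib-+ (suc m) _ _ ⟩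
    sumℚ (suc m) (λ k → β k * φ (suc l) k) +ℚ sumℚ (suc m) (λ k → β k * φ l k)
      ≡⟨ cong₂ _+ℚ_ (FSum≡sumℚ-signedBinom (suc l) m s) (FSum≡sumℚ-signedBinom l m s) ⟨
    FSum q (suc l) m s +ℚ FSum q l m s ∎
    where
    β : ℕ → ℚ
    β = signedBinom m
    φ : ℕ → ℕ → ℚ
    φ j k = quotientBinom j (+ k - s)

  FSum-pascal : ∀ l m s → FSum q l (suc m) s ≡ FSum q l m s ℚ.- FSum q l m (s - + 1)
  FSum-pascal l m s = begin
    FSum q l (suc m) s
      ≡⟨ FSum≡sumℚ-signedBinom l (suc m) s ⟩
    sumℚ (suc (suc m)) (λ k → signedBinom (suc m) k * φ k)
      ≡⟨ sumℚ-signedBinom-suc m φ ⟩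
    sumℚ (suc m) (λ k → signedBinom m k * (φ k ℚ.- φ (suc k)))
      ≡⟨ sumℚ-cong (suc m) (λ k _ → trans
           (cong (λ z → signedBinom m k * (φ k ℚ.- quotientBinom l z)) (shift (+ k) s))
           (*-distribˡ-minus (signedBinom m k) (φ k) (quotientBinom l (+ k - (s - + 1))))) ⟩
    sumℚ (suc m) (λ k → signedBinom m k * φ k ℚ.- signedBinom m k * quotientBinom l (+ k - (s - + 1)))
      ≡⟨ sumℚ-distrib-minus (suc m) _ _ ⟩
    sumℚ (suc m) (λ k → signedBinom m k * φ k)
      ℚ.- sumℚ (suc m) (λ k → signedBinom m k * quotientBinom l (+ k - (s - + 1)))
      ≡⟨ cong₂ ℚ._-_ (FSum≡sumℚ-signedBinom l m s) (FSum≡sumℚ-signedBinom l m (s - + 1)) ⟨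
    FSum q l m s ℚ.- FSum q l m (s - + 1) ∎
    where
    φ : ℕ → ℚ
    φ k = quotientBinom l (+ k - s)
    shift : ∀ k s → (+ 1 ℤ.+ k) - s ≡ k - (s - + 1)
    shift = solve-∀

  FSum-iterate : ∀ l m t r →
    FSum q l (m + t) r ≡ sumℚ (suc t) (λ i → signedBinom t i * FSum q l m (r - + i))
  FSum-iterate l m zero r = begin
    FSum q l (m + 0) r         ≡⟨ cong₂ (FSum q l) (ℕP.+-identityʳ m) (sym (ℤP.+-identityʳ r)) ⟩
    FSum q l m (r - + 0)       ≡⟨ trans (ℚP.+-identityˡ _) (ℚP.*-identityˡ _) ⟨
    sumℚ 1 (λ i → signedBinom 0 i * FSum q l m (r - + i)) ∎
  FSum-iterate l m (suc t) r = begin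
    FSum q l (m + suc t) r
      ≡⟨ cong (λ n → FSum q l n r) (ℕP.+-suc m t) ⟩
    FSum q l (suc (m + t)) r
      ≡⟨ FSum-pascal l (m + t) r ⟩
    FSum q l (m + t) r ℚ.- FSum q l (m + t) (r - + 1)
      ≡⟨ cong₂ ℚ._-_ (FSum-iterate l m t r) (FSum-iterate l m t (r - + 1)) ⟩
    sumℚ (suc t) (λ i → signedBinom t i * φ i) ℚ.- sumℚ (suc t) (λ i → signedBinom t i * FSum q l m ((r - + 1) - + i))
      ≡⟨ cong (ℚ._-_ (sumℚ (suc t) (λ i → signedBinom t i * φ i)))
           (sumℚ-cong (suc t) (λ i _ → cong (λ z → signedBinom t i * FSum q l m z) (shift r (+ i)))) ⟩
    sumℚ (suc t) (λ i → signedBinom t i * φ i) ℚ.- sumℚ (suc t) (λ i → signedBinom t i * φ (suc i))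
      ≡⟨ sumℚ-distrib-minus (suc t) _ _ ⟨
    sumℚ (suc t) (λ i → signedBinom t i * φ i ℚ.- signedBinom t i * φ (suc i))
      ≡⟨ sumℚ-cong (suc t) (λ i _ → *-distribˡ-minus (signedBinom t i) (φ i) (φ (suc i))) ⟨
    sumℚ (suc t) (λ i → signedBinom t i * (φ i ℚ.- φ (suc i)))
      ≡⟨ sumℚ-signedBinom-suc t φ ⟨
    sumℚ (suc (suc t)) (λ i → signedBinom (suc t) i * φ i) ∎
    where
    φ : ℕ → ℚ
    φ i = FSum q l m (r - + i)
    shift : ∀ r i → (r - + 1) - i ≡ r - (+ 1 ℤ.+ i)
    shift = solve-∀

  FSum-window : ∀ l m r → sumℚ p (λ j → FSum q l (suc m) (r - + j)) ≡ - lowerSum l m r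
  FSum-window l m r = begin
    sumℚ p (λ j → FSum q l (suc m) (r - + j))
      ≡⟨ sumℚ-cong p (λ j _ → trans (FSum-pascal l m (r - + j))
                                      (cong (λ z → ψ j ℚ.- FSum q l m z) (shift r (+ j)))) ⟩
    sumℚ p (λ j → ψ j ℚ.- ψ (suc j))
      ≡⟨ sumℚ-telescope p ψ ⟩
    ψ 0 ℚ.- ψ p
      ≡⟨ cong₂ ℚ._-_ (cong (FSum q l m) (ℤP.+-identityʳ r)) (FSum-+p l m r) ⟩
    FSum q l m r ℚ.- (FSum q l m r +ℚ lowerSum l m r)
      ≡⟨ cancel (FSum q l m r) (lowerSum l m r) ⟩
    - lowerSum l m r ∎
    where
    ψ : ℕ → ℚ
    ψ j = FSum q l m (r - + j)
    shift : ∀ r j → (r - j) - + 1 ≡ r - (+ 1 ℤ.+ j)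
    shift = solve-∀
    cancel : ∀ a b → a ℚ.- (a +ℚ b) ≡ - b
    cancel = solve 2 (λ a b → a :- (a :+ b) := :- b) refl

  exponent : ℕ → ℕ → ℤ
  exponent n l = (+ n - + (l ℕ.* p) - + 1) ℤ./ℕ suc q

  exponent-+[p-1] : ∀ n l → exponent (n + suc q) l ≡ ℤ.suc (exponent n l)
  exponent-+[p-1] n l = trans (cong (ℤ._/ℕ suc q) (begin
    + (n + suc q) - + (l ℕ.* p) - + 1      ≡⟨ cong (λ z → z - + (l ℕ.* p) - + 1) (ℤP.pos-+ n (suc q)) ⟩
    (+ n ℤ.+ + suc q) - + (l ℕ.* p) - + 1  ≡⟨ regroup (+ n) (+ suc q) (+ (l ℕ.* p)) ⟩
    + suc q ℤ.+ (+ n - + (l ℕ.* p) - + 1)  ∎)) (/ℕ-+d (+ n - + (l ℕ.* p) - + 1) (suc q))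
    where
    regroup : ∀ n d c → (n ℤ.+ d) - c - + 1 ≡ d ℤ.+ (n - c - + 1)
    regroup = solve-∀

  exponent-+p : ∀ n l → exponent (n + p) (suc l) ≡ exponent n l
  exponent-+p n l = cong (ℤ._/ℕ suc q) (begin
    + (n + p) - + (p + l ℕ.* p) - + 1
      ≡⟨ cong₂ (λ a b → a - b - + 1) (ℤP.pos-+ n p) (ℤP.pos-+ p (l ℕ.* p)) ⟩
    (+ n ℤ.+ + p) - (+ p ℤ.+ + (l ℕ.* p)) - + 1  ≡⟨ cancel (+ n) (+ p) (+ (l ℕ.* p)) ⟩
    + n - + (l ℕ.* p) - + 1                      ∎)
    where
    cancel : ∀ n p c → (n ℤ.+ p) - (p ℤ.+ c) - + 1 ≡ n - c - + 1
    cancel = solve-∀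

  exponent-nonpos : ∀ n l → n ℕ.≤ suc q → exponent n l ℤ.≤ + 0
  exponent-nonpos n l n≤p-1 = /ℕ-nonpos _ (suc q) (ℤP.≤-<-trans
    (ℤP.+-monoˡ-≤ -1ℤ (ℤP.i-j≤i (+ n) (+ (l ℕ.* p))))
    (ℤP.<-≤-trans (subst (ℤ._< + n) (ℤP.+-comm -1ℤ (+ n)) (ℤP.i≤pred[j]⇒i<j ℤP.≤-refl)) (ℤ.+≤+ n≤p-1)))

  negPowNeg-suc : ∀ z → negPowNeg q z ≡ - toℚ (+ p) * negPowNeg q (ℤ.suc z)
  negPowNeg-suc (+ m) = *-cancelʳ-toℚ (p ℕ.^ suc m) {{ℕP.m^n≢0 p (suc m)}} (begin
    N * toℚ (+ (p ℕ.* p ℕ.^ m))          ≡⟨ cong (N *_) (toℚ-pos-* p (p ℕ.^ m)) ⟩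
    N * (P * toℚ (+ (p ℕ.^ m)))          ≡⟨ swap N P _ ⟩
    P * (N * toℚ (+ (p ℕ.^ m)))          ≡⟨ cong (P *_) (i/n*n≡i s (p ℕ.^ m) {{ℕP.m^n≢0 p m}}) ⟩
    P * toℚ s                            ≡⟨ negate P (toℚ s) ⟩
    - P * (- ℚ.1ℚ * toℚ s)               ≡⟨ cong (- P *_) (toℚ-homo-* -1ℤ s) ⟨
    - P * toℚ (-1ℤ ℤ.^ suc m)
      ≡⟨ cong (- P *_) (i/n*n≡i (-1ℤ ℤ.^ suc m) (p ℕ.^ suc m) {{ℕP.m^n≢0 p (suc m)}}) ⟨
    - P * (N′ * toℚ (+ (p ℕ.^ suc m)))   ≡⟨ ℚP.*-assoc (- P) N′ _ ⟨
    - P * N′ * toℚ (+ (p ℕ.^ suc m))     ∎)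
    where
    s = -1ℤ ℤ.^ m
    P = toℚ (+ p)
    N = negPowNeg q (+ m)
    N′ = negPowNeg q (+ suc m)
    swap : ∀ a b c → a * (b * c) ≡ b * (a * c)
    swap = solve 3 (λ a b c → a :* (b :* c) := b :* (a :* c)) refl
    negate : ∀ a b → a * b ≡ - a * (- ℚ.1ℚ * b)
    negate = solve 2 (λ a b → a :* b := :- a :* (:- con ℚ.1ℚ :* b)) refl
  negPowNeg-suc -[1+ zero ]  = trans (toℚ-homo-* (ℤ.- + p) (+ 1)) (cong (_* toℚ (+ 1)) (toℚ-homo‿- (+ p)))
  negPowNeg-suc -[1+ suc m ] =
    trans (toℚ-homo-* (ℤ.- + p) ((ℤ.- + p) ℤ.^ suc m)) (cong (_* negPowNeg q -[1+ m ]) (toℚ-homo‿- (+ p)))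

-- The recurrence for F and its consequences

module FModP (q : ℕ) (isPrime : Prime (suc (suc q))) where

  open FProperties q
  open PIntegral isPrime

  P : ℚ
  P = toℚ (+ p)

  coefficient : ℕ → ℚ
  coefficient = signedBinomDefect (suc q)

  isPIntegral-1/[1+k<p-1] : ∀ {k} → k < suc q → IsPIntegral p 1/[1+ k ]
  isPIntegral-1/[1+k<p-1] {k} k<p-1 =
    isPIntegral-1/[1+k] k (λ p∣1+k → ℕP.<-irrefl refl (ℕP.≤-trans (∣⇒≤ p∣1+k) k<p-1))

  isPIntegral-harmonic : ∀ {i} → i ℕ.≤ suc q → IsPIntegral p (harmonic i)
  isPIntegral-harmonic {i} i≤p-1 =
    isPIntegral-sumℚ i (λ k k<i → isPIntegral-1/[1+k<p-1] (ℕP.<-≤-trans k<i i≤p-1))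

  isPIntegral-coefficient : ∀ {i} → i ℕ.≤ suc q → IsPIntegral p (coefficient i)
  isPIntegral-coefficient {i} i≤p-1 = isPIntegral-sumℚ i (λ k k<i →
    isPIntegral-* (isPIntegral-1/[1+k<p-1] (ℕP.<-≤-trans k<i i≤p-1))
                  (isPIntegral-toℚ (+ (suc q C k) ℤ.* (-1ℤ ℤ.^ k))))

  isPIntegral-quotientBinom : ∀ l z → IsPIntegral p (quotientBinom l z)
  isPIntegral-quotientBinom l z with z ℤ.%ℕ p
  ... | zero  = isPIntegral-gbinom (z ℤ./ℕ p) l
  ... | suc _ = isPIntegral-0

  isPIntegral-FSum : ∀ l n r → IsPIntegral p (FSum q l n r)
  isPIntegral-FSum l n r = isPIntegral-cong (sym (FSum≡sumℚ-signedBinom l n r))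
    (isPIntegral-sumℚ (suc n) (λ k _ →
      isPIntegral-* (isPIntegral-toℚ (+ (n C k) ℤ.* (-1ℤ ℤ.^ k))) (isPIntegral-quotientBinom l (+ k - r))))

  isPIntegral-negPowNeg : ∀ {z} → z ℤ.≤ + 0 → IsPIntegral p (negPowNeg q z)
  isPIntegral-negPowNeg (ℤ.+≤+ z≤n) = isPIntegral-toℚ (+ 1)
  isPIntegral-negPowNeg { -[1+ m ]} ℤ.-≤+ = isPIntegral-toℚ ((ℤ.- + p) ℤ.^ suc m)

  negPowNeg[suc] : ∀ m l → negPowNeg q (exponent (suc m) l) ≡ - P * negPowNeg q (exponent (m + p) l)
  negPowNeg[suc] m l = trans (negPowNeg-suc (exponent (suc m) l))
    (cong (λ n → - P * negPowNeg q n) (sym (trans (cong (λ n → exponent n l) (ℕP.+-suc m (suc q)))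
                                                  (exponent-+[p-1] (suc m) l))))

  lowerTerm≡ : ∀ l m r → lowerTerm p l m r ≡ negPowNeg q (exponent (m + p) l) * lowerSum l m r
  lowerTerm≡ zero    m r = sym (ℚP.*-zeroʳ (negPowNeg q (exponent (m + p) 0)))
  lowerTerm≡ (suc l) m r = cong (λ e → negPowNeg q e * FSum q l m r) (sym (exponent-+p m l))

  F-recurrence : ∀ l m r →
    F p l (m + p) r +ℚ lowerTerm p l m r ≡ sumℚ p (λ i → coefficient i * F p l (suc m) (r - + i))
  F-recurrence l m r = begin
    F p l (m + p) r +ℚ lowerTerm p l m r
      ≡⟨ cong₂ _+ℚ_ (cong (N *_) FSum[m+p]) (lowerTerm≡ l m r) ⟩
    N * sumℚ p (λ i → signedBinom (suc q) i * U i) +ℚ N * lowerSum l m r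
      ≡⟨ cong (λ w → N * sumℚ p (λ i → signedBinom (suc q) i * U i) +ℚ N * w) lowerSum≡ ⟩
    N * sumℚ p (λ i → signedBinom (suc q) i * U i) +ℚ N * (- sumℚ p U)
      ≡⟨ distribute N (sumℚ p (λ i → signedBinom (suc q) i * U i)) (sumℚ p U) ⟩
    N * sumℚ p (λ i → signedBinom (suc q) i * U i) ℚ.- N * sumℚ p U
      ≡⟨ cong₂ ℚ._-_ (*-distribˡ-sumℚ p N _) (*-distribˡ-sumℚ p N U) ⟩
    sumℚ p (λ i → N * (signedBinom (suc q) i * U i)) ℚ.- sumℚ p (λ i → N * U i)
      ≡⟨ sumℚ-distrib-minus p _ _ ⟨
    sumℚ p (λ i → N * (signedBinom (suc q) i * U i) ℚ.- N * U i)
      ≡⟨ sumℚ-cong p (λ i _ → summand i) ⟩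
    sumℚ p (λ i → coefficient i * F p l (suc m) (r - + i)) ∎
    where
    N = negPowNeg q (exponent (m + p) l)
    U : ℕ → ℚ
    U i = FSum q l (suc m) (r - + i)
    FSum[m+p] : FSum q l (m + p) r ≡ sumℚ p (λ i → signedBinom (suc q) i * U i)
    FSum[m+p] = trans (cong (λ n → FSum q l n r) (ℕP.+-suc m (suc q))) (FSum-iterate l (suc m) (suc q) r)
    lowerSum≡ : lowerSum l m r ≡ - sumℚ p U
    lowerSum≡ = trans (involutive (lowerSum l m r)) (cong -_ (sym (FSum-window l m r)))
      where
      involutive : ∀ a → a ≡ - - a
      involutive = solve 1 (λ a → a := :- :- a) refl
    distribute : ∀ n a b → n * a +ℚ n * (- b) ≡ n * a ℚ.- n * b
    distribute = solve 3 (λ n a b → n :* a :+ n :* (:- b) := n :* a :- n :* b) refl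
    summand : ∀ i → N * (signedBinom (suc q) i * U i) ℚ.- N * U i ≡ coefficient i * F p l (suc m) (r - + i)
    summand i = begin
      N * (signedBinom (suc q) i * U i) ℚ.- N * U i
        ≡⟨ cong (λ β → N * (β * U i) ℚ.- N * U i) (signedBinom≡1-[1+t]*defect (suc q) i) ⟩
      N * ((ℚ.1ℚ ℚ.- P * coefficient i) * U i) ℚ.- N * U i
        ≡⟨ rearrange N P (coefficient i) (U i) ⟩
      coefficient i * ((- P * N) * U i)
        ≡⟨ cong (λ w → coefficient i * (w * U i)) (negPowNeg[suc] m l) ⟨
      coefficient i * F p l (suc m) (r - + i) ∎
      where
      rearrange : ∀ n p c u → n * ((ℚ.1ℚ ℚ.- p * c) * u) ℚ.- n * u ≡ c * ((- p * n) * u)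
      rearrange = solve 4 (λ n p c u → n :* ((con ℚ.1ℚ :- p :* c) :* u) :- n :* u := c :* ((:- p :* n) :* u)) refl

  sumℚ-F-window : ∀ l m r → sumℚ p (λ i → F p l (suc m) (r - + i)) ≡ P * lowerTerm p l m r
  sumℚ-F-window l m r = begin
    sumℚ p (λ i → N′ * FSum q l (suc m) (r - + i))   ≡⟨ *-distribˡ-sumℚ p N′ _ ⟨
    N′ * sumℚ p (λ i → FSum q l (suc m) (r - + i))   ≡⟨ cong₂ _*_ (negPowNeg[suc] m l) (FSum-window l m r) ⟩
    (- P * N) * (- lowerSum l m r)                   ≡⟨ cancel P N (lowerSum l m r) ⟩
    P * (N * lowerSum l m r)                         ≡⟨ cong (P *_) (lowerTerm≡ l m r) ⟨
    P * lowerTerm p l m r                            ∎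
    where
    N = negPowNeg q (exponent (m + p) l)
    N′ = negPowNeg q (exponent (suc m) l)
    cancel : ∀ p n a → (- p * n) * (- a) ≡ p * (n * a)
    cancel = solve 3 (λ p n a → (:- p :* n) :* (:- a) := p :* (n :* a)) refl

  isPIntegral-lowerTerm : ∀ {m} → (∀ l r → IsPIntegral p (F p l m r)) → ∀ l r → IsPIntegral p (lowerTerm p l m r)
  isPIntegral-lowerTerm F∈ℤₚ zero    r = isPIntegral-0
  isPIntegral-lowerTerm F∈ℤₚ (suc l) r = F∈ℤₚ l r

  isPIntegral-F : ∀ n l r → IsPIntegral p (F p l n r)
  isPIntegral-F = <-rec (λ n → ∀ l r → IsPIntegral p (F p l n r)) step
    where
    step : ∀ n → (∀ {k} → k < n → ∀ l r → IsPIntegral p (F p l k r)) → ∀ l r → IsPIntegral p (F p l n r)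
    step n rec l r with n ℕ.≤? suc q
    ... | yes n≤p-1 = isPIntegral-* (isPIntegral-negPowNeg (exponent-nonpos n l n≤p-1)) (isPIntegral-FSum l n r)
    ... | no  n≰p-1 = subst (λ n → IsPIntegral p (F p l n r)) m+p≡n (isPIntegral-cong (sym F[m+p]≡)
          (isPIntegral-minus
            (isPIntegral-sumℚ p (λ i i<p → isPIntegral-*
              (isPIntegral-coefficient (ℕP.≤-pred i<p)) (rec 1+m<n l (r - + i))))
            (isPIntegral-lowerTerm (rec (ℕP.<-trans (ℕP.n<1+n m) 1+m<n)) l r)))
      where
      m = n ∸ p
      m+p≡n : m + p ≡ n
      m+p≡n = ℕP.m∸n+n≡m (ℕP.≰⇒> n≰p-1)
      1+m<n : suc m < n
      1+m<n = subst (suc m <_) (trans (sym (ℕP.+-suc m (suc q))) m+p≡n) (s≤s (ℕP.m<m+n m (s≤s z≤n)))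
      F[m+p]≡ : F p l (m + p) r ≡ sumℚ p (λ i → coefficient i * F p l (suc m) (r - + i)) ℚ.- lowerTerm p l m r
      F[m+p]≡ = trans (sym (+-minus-cancelʳ (F p l (m + p) r) (lowerTerm p l m r)))
                      (cong (ℚ._- lowerTerm p l m r) (F-recurrence l m r))

  correction : ℕ → ℚ
  correction j = sumℚ j (λ k → 1/[1+ k ] * coefficient k)

  isPIntegral-correction : ∀ {j} → j ℕ.≤ suc q → IsPIntegral p (correction j)
  isPIntegral-correction {j} j≤p-1 = isPIntegral-sumℚ j (λ k k<j → isPIntegral-*
    (isPIntegral-1/[1+k<p-1] (ℕP.<-≤-trans k<j j≤p-1))
    (isPIntegral-coefficient (ℕP.≤-trans (ℕP.<⇒≤ k<j) j≤p-1)))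

  F+lowerTerm+harmonicSum : ∀ l m r → let Fu = λ j → F p l (suc m) (r - + j) in
    (F p l (m + p) r +ℚ lowerTerm p l m r) +ℚ sumℚ (suc q) (λ k → 1/[1+ k ] * sumℚ (suc k) Fu)
      ≡ P * (harmonic (suc q) * lowerTerm p l m r ℚ.- sumℚ p (λ j → correction j * Fu j))
  F+lowerTerm+harmonicSum l m r = begin
    (F p l (m + p) r +ℚ L) +ℚ sumℚ (suc q) (λ k → 1/[1+ k ] * sumℚ (suc k) Fu)
      ≡⟨ cong₂ _+ℚ_ (F-recurrence l m r) (sumℚ-exchange (suc q) 1/[1+_] Fu) ⟩
    sumℚ p (λ j → coefficient j * Fu j) +ℚ sumℚ p (λ j → (H ℚ.- harmonic j) * Fu j)
      ≡⟨ sumℚ-distrib-+ p _ _ ⟨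
    sumℚ p (λ j → coefficient j * Fu j +ℚ (H ℚ.- harmonic j) * Fu j)
      ≡⟨ sumℚ-cong p (λ j _ → trans (cong (λ c → c * Fu j +ℚ (H ℚ.- harmonic j) * Fu j)
                                            (signedBinomDefect-harmonic (suc q) j))
                                      (regroup (harmonic j) P (correction j) H (Fu j))) ⟩
    sumℚ p (λ j → H * Fu j ℚ.- P * (correction j * Fu j))
      ≡⟨ sumℚ-distrib-minus p _ _ ⟩
    sumℚ p (λ j → H * Fu j) ℚ.- sumℚ p (λ j → P * (correction j * Fu j))
      ≡⟨ cong₂ ℚ._-_ (*-distribˡ-sumℚ p H Fu) (*-distribˡ-sumℚ p P (λ j → correction j * Fu j)) ⟨
    H * sumℚ p Fu ℚ.- P * C
      ≡⟨ cong (λ w → H * w ℚ.- P * C) (sumℚ-F-window l m r) ⟩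
    H * (P * L) ℚ.- P * C
      ≡⟨ factor H P L C ⟩
    P * (H * L ℚ.- C) ∎
    where
    L = lowerTerm p l m r
    Fu : ℕ → ℚ
    Fu j = F p l (suc m) (r - + j)
    H = harmonic (suc q)
    C = sumℚ p (λ j → correction j * Fu j)
    regroup : ∀ h p d H f → (h ℚ.- p * d) * f +ℚ (H ℚ.- h) * f ≡ H * f ℚ.- p * (d * f)
    regroup = solve 5 (λ h p d H f → (h :- p :* d) :* f :+ (H :- h) :* f := H :* f :- p :* (d :* f)) refl
    factor : ∀ h p l c → h * (p * l) ℚ.- p * c ≡ p * (h * l ℚ.- c)
    factor = solve 4 (λ h p l c → h :* (p :* l) :- p :* c := p :* (h :* l :- c)) refl

  F+lowerTerm-congruence : ∀ l n r → p ℕ.≤ n →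
    (F p l n r +ℚ lowerTerm p l (n ∸ p) r)
      ≡ (- sumℚ (suc q) (λ k → 1/[1+ k ] * sumℚ (suc k) (λ j → F p l (n ∸ p + 1) (r - + j)))) [modℚ p ]
  F+lowerTerm-congruence l n r p≤n = y , isPIntegral⇒isPAdicInt y∈ℤₚ , (begin
    (F p l n r +ℚ L) ℚ.- (- X (m + 1))
      ≡⟨ cong₂ (λ n′ x → (F p l n′ r +ℚ L) ℚ.- (- x)) (sym (ℕP.m∸n+n≡m p≤n))
               (cong X (ℕP.+-comm m 1)) ⟩
    (F p l (m + p) r +ℚ L) ℚ.- (- X (suc m))
      ≡⟨ minus-neg (F p l (m + p) r +ℚ L) (X (suc m)) ⟩
    (F p l (m + p) r +ℚ L) +ℚ X (suc m)
      ≡⟨ F+lowerTerm+harmonicSum l m r ⟩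
    P * y ∎)
    where
    m = n ∸ p
    L = lowerTerm p l m r
    X : ℕ → ℚ
    X m′ = sumℚ (suc q) (λ k → 1/[1+ k ] * sumℚ (suc k) (λ j → F p l m′ (r - + j)))
    y = harmonic (suc q) * L ℚ.- sumℚ p (λ j → correction j * F p l (suc m) (r - + j))
    y∈ℤₚ : IsPIntegral p y
    y∈ℤₚ = isPIntegral-minus
      (isPIntegral-* (isPIntegral-harmonic ℕP.≤-refl) (isPIntegral-lowerTerm (isPIntegral-F m) l r))
      (isPIntegral-sumℚ p (λ j j<p →
        isPIntegral-* (isPIntegral-correction (ℕP.≤-pred j<p)) (isPIntegral-F (suc m) l (r - + j))))
    minus-neg : ∀ a x → a ℚ.- (- x) ≡ a +ℚ x
    minus-neg = solve 2 (λ a x → a :- (:- x) := a :+ x) refl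

lemma5p2 : (p : ℕ) → Prime p → (l n : ℕ) → p < n → (r : ℤ) →
    (F p l n r +ℚ lowerTerm p l (n ∸ p) r)
      ≡ (- sumℚ (p ∸ 1) (λ k′ → ((+ 1) / suc k′) * sumℚ (suc k′) (λ j → F p l (n ∸ p + 1) (r - + j)))) [modℚ p ]
lemma5p2 zero          isPrime = ⊥-elim (¬prime[0] isPrime)
lemma5p2 (suc zero)    isPrime = ⊥-elim (¬prime[1] isPrime)
lemma5p2 (suc (suc q)) isPrime l n p<n r = FModP.F+lowerTerm-congruence q isPrime l n r (ℕP.<⇒≤ p<n)
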